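{- Let $n\ge2$, let $c\in\mathcal{CC}_n$ and let $i\in[n-1]$ with $c_i\ne0$. Let $c'$ be the $(n-1)$-tuple with $c'_i=0$ and $c'_j=c_j$ for all $j\ne i$. Then $c'\in\mathcal{CC}_n$.
   Context: Tamari diagram of size $n$: a word $u=u_1\cdots u_n$ of integers with $0\le u_i\le n-i$ and $u_{i+j}\le u_i-j$ for all $i\in[n]$, $0\le j\le u_i$. Dual Tamari diagram of size $n$: a word $v=v_1\cdots v_n$ of integers with $0\le v_i\le i-1$ and $v_{i-j}\le v_i-j$ for all $i\in[n]$, $0\le j\le v_i$. A pair $(u,v)$ of a Tamari diagram and a dual Tamari diagram of size $n$ is a Tamari interval diagram if for all $1\le i<j\le n$ with $j-i\le u_i$ one has $v_j<j-i$. An $(n-1)$-tuple $c$ of integers is a cubic coordinate of size $n$ if the pair $(u,v)$ with $u_i=\max(c_i,0)$ ($i\in[n-1]$), $u_n=0$, $v_1=0$, $v_i=|\min(c_{i-1},0)|$ ($2\le i\le n$) is a Tamari interval diagram; $\mathcal{CC}_n$ is their set. -}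

module Defs where

open import Data.Nat using (ℕ; zero; suc; _+_; _∸_; _≤_; _<_)
open import Data.Integer as ℤ using (ℤ; ∣_∣; _⊔_; _⊓_; +_)
open import Data.Fin using (Fin; toℕ)
open import Data.Vec using (Vec; []; _∷_; lookup; _[_]≔_)
open import Data.Product using (_×_)

-- Words of integers of size n are represented 1-based as functions ℕ → ℕ;
-- only the values at positions 1..n matter.

IsTamariDiagram : (n : ℕ) → (ℕ → ℕ) → Set
IsTamariDiagram n u =
  ∀ i → 1 ≤ i → i ≤ n →
    (u i ≤ n ∸ i) × (∀ j → j ≤ u i → u (i + j) ≤ u i ∸ j)

IsDualTamariDiagram : (n : ℕ) → (ℕ → ℕ) → Set
IsDualTamariDiagram n v =
  ∀ i → 1 ≤ i → i ≤ n →
    (v i ≤ i ∸ 1) × (∀ j → j ≤ v i → v (i ∸ j) ≤ v i ∸ j)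

IsTamariIntervalDiagram : (n : ℕ) → (ℕ → ℕ) → (ℕ → ℕ) → Set
IsTamariIntervalDiagram n u v =
  IsTamariDiagram n u × IsDualTamariDiagram n v ×
  (∀ i j → 1 ≤ i → i < j → j ≤ n → j ∸ i ≤ u i → v j < j ∸ i)

-- 1-based access to an (n-1)-tuple c = (c_1, ..., c_m), m = n - 1:
-- entry c k = c_k for 1 ≤ k ≤ m; out-of-range positions give 0
-- (they are never consulted by the range-restricted conditions).
entry : {m : ℕ} → Vec ℤ m → ℕ → ℤ
entry [] _ = + 0
entry (x ∷ c) zero = + 0
entry (x ∷ c) (suc zero) = x
entry (x ∷ c) (suc (suc k)) = entry c (suc k)

uOf : {m : ℕ} → Vec ℤ m → ℕ → ℕ
uOf c i = ∣ entry c i ⊔ + 0 ∣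

-- v_1 = 0, v_i = |min(c_{i-1}, 0)| for 2 ≤ i ≤ n
vOf : {m : ℕ} → Vec ℤ m → ℕ → ℕ
vOf c zero = 0
vOf c (suc k) = ∣ entry c k ⊓ + 0 ∣

-- cubic coordinate of size n = suc m (an m-tuple of integers)
IsCubicCoordinate : (m : ℕ) → Vec ℤ m → Set
IsCubicCoordinate m c = IsTamariIntervalDiagram (suc m) (uOf c) (vOf c)

module Submission where

-- Setting an entry c_i to 0 only ever lowers the associated
-- words: every u'_k is either u_k or 0, and likewise every v'_k is either
-- v_k or 0.  All three defining conditions of a Tamari interval diagram
-- survive such a "reset to 0" of some letters:
--   * the Tamari and dual Tamari conditions bound a letter at a position
--     reachable from i by letters that only shrink; if the letter at i
--     itself became 0, the only constraint left is the trivial one at i;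
--   * the compatibility condition has a hypothesis j - i ≤ u_i that only
--     becomes stronger and a conclusion v_j < j - i that only becomes weaker.

open import Defs
open import Data.Nat using (ℕ; suc; zero; _≤_; _∸_; _+_; z≤n)
open import Data.Nat.Properties using (≤-reflexive; ≤-trans; ≤-<-trans; n≤0⇒n≡0; +-identityʳ)
open import Data.Integer using (ℤ; +_; ∣_∣; _⊔_; _⊓_)
open import Data.Fin using (Fin)
open import Data.Vec using (Vec; lookup; _[_]≔_; _∷_)
open import Data.Product using (_,_)
open import Data.Sum using (_⊎_; inj₁; inj₂; map)
open import Function using (_∘_)
open import Relation.Nullary using (¬_)
open import Relation.Binary.PropositionalEquality using (_≡_; refl; trans; cong)

Reset : {A : Set} → A → (ℕ → A) → (ℕ → A) → Set
Reset z f g = ∀ k → f k ≡ g k ⊎ f k ≡ z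

reset-map : {A B : Set} {z : A} {f g : ℕ → A} (h : A → B) →
  Reset z f g → Reset (h z) (h ∘ f) (h ∘ g)
reset-map h r k = map (cong h) (cong h) (r k)

reset-≤ : {f g : ℕ → ℕ} → Reset 0 f g → ∀ k → f k ≤ g k
reset-≤ r k with r k
... | inj₁ f≡g = ≤-reflexive f≡g
... | inj₂ f≡0 = ≤-trans (≤-reflexive f≡0) z≤n

-- The letters reached from position i along a path s (with s 0 = i) are
-- bounded by "f i minus the distance".  For s j = i + j this is the Tamari
-- condition, for s j = i ∸ j the dual one.
BoundedFrom : (ℕ → ℕ) → (ℕ → ℕ) → ℕ → Set
BoundedFrom f s i = ∀ j → j ≤ f i → f (s j) ≤ f i ∸ j

-- BoundedFrom survives a reset to 0: a kept letter inherits the bound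
-- since all other letters only shrank; a zeroed letter only constrains
-- itself (j = 0), where the bound reads 0 ≤ 0.
reset-boundedFrom : {f g : ℕ → ℕ} (s : ℕ → ℕ) (i : ℕ) →
  Reset 0 f g → s 0 ≡ i → BoundedFrom g s i → BoundedFrom f s i
reset-boundedFrom {f} s i r s0≡i bounded j j≤fi with r i
... | inj₁ fi≡gi rewrite fi≡gi =
  ≤-trans (reset-≤ r (s j)) (bounded j j≤fi)
... | inj₂ fi≡0 rewrite fi≡0 | n≤0⇒n≡0 j≤fi =
  ≤-reflexive (trans (cong f s0≡i) fi≡0)

reset-tamari : ∀ {n} {u u' : ℕ → ℕ} → Reset 0 u' u →
  IsTamariDiagram n u → IsTamariDiagram n u'
reset-tamari r tamari i 1≤i i≤n =
  let (u≤ , bounded) = tamari i 1≤i i≤n in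
  ≤-trans (reset-≤ r i) u≤ ,
  reset-boundedFrom (λ j → i + j) i r (+-identityʳ i) bounded

reset-dualTamari : ∀ {n} {v v' : ℕ → ℕ} → Reset 0 v' v →
  IsDualTamariDiagram n v → IsDualTamariDiagram n v'
reset-dualTamari r dual i 1≤i i≤n =
  let (v≤ , bounded) = dual i 1≤i i≤n in
  ≤-trans (reset-≤ r i) v≤ ,
  reset-boundedFrom (λ j → i ∸ j) i r refl bounded

-- Tamari interval diagrams are closed under resetting letters of both
-- words to 0: the compatibility hypothesis j - i ≤ u'_i implies
-- j - i ≤ u_i, and v'_j ≤ v_j < j - i.
reset-interval : ∀ {n} {u v u' v' : ℕ → ℕ} → Reset 0 u' u → Reset 0 v' v →
  IsTamariIntervalDiagram n u v → IsTamariIntervalDiagram n u' v'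
reset-interval ru rv (tamari , dual , compatible) =
  reset-tamari ru tamari ,
  reset-dualTamari rv dual ,
  λ i j 1≤i i<j j≤n j∸i≤u'i →
    ≤-<-trans (reset-≤ rv j)
      (compatible i j 1≤i i<j j≤n (≤-trans j∸i≤u'i (reset-≤ ru i)))

entry-zeroing : ∀ {m} (c : Vec ℤ m) (i : Fin m) →
  Reset (+ 0) (entry (c [ i ]≔ + 0)) (entry c)
entry-zeroing (x ∷ c) Fin.zero zero = inj₁ refl
entry-zeroing (x ∷ c) Fin.zero (suc zero) = inj₂ refl
entry-zeroing (x ∷ c) Fin.zero (suc (suc k)) = inj₁ refl
entry-zeroing (x ∷ c) (Fin.suc i) zero = inj₁ refl
entry-zeroing (x ∷ c) (Fin.suc i) (suc zero) = inj₁ refl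
entry-zeroing (x ∷ c) (Fin.suc i) (suc (suc k)) = entry-zeroing c i (suc k)

uOf-zeroing : ∀ {m} (c : Vec ℤ m) (i : Fin m) →
  Reset 0 (uOf (c [ i ]≔ + 0)) (uOf c)
uOf-zeroing c i = reset-map (λ z → ∣ z ⊔ + 0 ∣) (entry-zeroing c i)

vOf-zeroing : ∀ {m} (c : Vec ℤ m) (i : Fin m) →
  Reset 0 (vOf (c [ i ]≔ + 0)) (vOf c)
vOf-zeroing c i zero = inj₁ refl
vOf-zeroing c i (suc k) = reset-map (λ z → ∣ z ⊓ + 0 ∣) (entry-zeroing c i) k

mainTheorem7 : (m : ℕ) → 1 ≤ m → (c : Vec ℤ m) → IsCubicCoordinate m c →
    (i : Fin m) → ¬ (lookup c i ≡ + 0) →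
    IsCubicCoordinate m (c [ i ]≔ + 0)
mainTheorem7 m _ c cubic i _ =
  reset-interval (uOf-zeroing c i) (vOf-zeroing c i) cubic
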